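{- Let $\mathcal{S}\subseteq 2^{[n]}$ be a Sperner family and let $h:\mathcal{S}\to 2^{[n]}$ be a function with $h(S)\subseteq S$ for every $S\in\mathcal{S}$. Then $\mathcal{F}=\mathcal{F}(\mathcal{S},h)$ is s-extremal with $\mathrm{Sh}(\mathcal{F})=\mathcal{H}(\mathcal{S})$ if and only if $|\mathcal{F}(\mathcal{S},h)|=|\mathcal{H}(\mathcal{S})|$.
   Context: $[n]=\{1,\dots,n\}$. A family $\mathcal{F}\subseteq 2^{[n]}$ shatters $S\subseteq[n]$ if $\{F\cap S: F\in\mathcal{F}\}=2^S$; $\mathrm{Sh}(\mathcal{F})$ is the family of sets shattered by $\mathcal{F}$. $\mathcal{F}$ is s-extremal if $|\mathrm{Sh}(\mathcal{F})|=|\mathcal{F}|$. A Sperner family is a family none of whose members contains another. For $H\subseteq S\subseteq[n]$ let $\mathcal{P}_S=\{S\cup B: B\subseteq [n]\setminus S\}$ and $\mathcal{Q}_{S,H}=\{H\cup B: B\subseteq[n]\setminus S\}$ (the sets whose intersection with $S$ is $H$). Define $\mathcal{H}(\mathcal{S})=2^{[n]}\setminus\bigcup_{S\in\mathcal{S}}\mathcal{P}_S$ (the sets containing no member of $\mathcal{S}$) and $\mathcal{F}(\mathcal{S},h)=2^{[n]}\setminus\bigcup_{S\in\mathcal{S}}\mathcal{Q}_{S,h(S)}$. -}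

module Defs where

open import Data.Nat using (ℕ; zero; suc)
open import Data.Bool using (Bool; true; false; not; _∧_)
import Data.Bool as B
open import Data.List using (List; []; _∷_; _++_; map; length; filterᵇ)
open import Data.Bool.ListAction using (any; all)
open import Data.Vec using (Vec; []; _∷_)
open import Data.Vec.Properties using (≡-dec)
open import Data.Fin.Subset using (Subset; _⊆_; _∩_; inside; outside)
open import Data.Fin.Subset.Properties using (_⊆?_)
open import Relation.Nullary.Decidable using (⌊_⌋)
open import Relation.Binary.PropositionalEquality using (_≡_)

Family : ℕ → Set
Family n = Subset n → Bool

-- Enumeration of all 2^n subsets of [n] (each exactly once).
allSubsets : (n : ℕ) → List (Subset n)
allSubsets zero = [] ∷ []
allSubsets (suc n) = map (outside ∷_) (allSubsets n) ++ map (inside ∷_) (allSubsets n)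

_=ˢ_ : ∀ {n} → Subset n → Subset n → Bool
X =ˢ Y = ⌊ ≡-dec B._≟_ X Y ⌋

_⊆ᵇ_ : ∀ {n} → Subset n → Subset n → Bool
X ⊆ᵇ Y = ⌊ X ⊆? Y ⌋

card : ∀ {n} → Family n → ℕ
card {n} 𝓕 = length (filterᵇ 𝓕 (allSubsets n))

-- 𝓕 shatters S : every T ⊆ S is of the form F ∩ S with F ∈ 𝓕
-- (the inclusion {F ∩ S} ⊆ 2^S is automatic).
shatters : ∀ {n} → Family n → Subset n → Bool
shatters {n} 𝓕 S =
  all (λ T → not (T ⊆ᵇ S) B.∨ any (λ F → 𝓕 F ∧ ((F ∩ S) =ˢ T)) (allSubsets n))
      (allSubsets n)

Sh : ∀ {n} → Family n → Family n
Sh 𝓕 S = shatters 𝓕 S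

SExtremal : ∀ {n} → Family n → Set
SExtremal 𝓕 = card (Sh 𝓕) ≡ card 𝓕

_≐_ : ∀ {n} → Family n → Family n → Set
_≐_ {n} 𝓐 𝓑 = (X : Subset n) → 𝓐 X ≡ 𝓑 X

Sperner : ∀ {n} → Family n → Set
Sperner {n} 𝓢 = (A B : Subset n) → 𝓢 A ≡ true → 𝓢 B ≡ true → A ⊆ B → A ≡ B

-- 𝓗(𝓢) = 2^[n] ∖ ⋃_{S∈𝓢} 𝓟_S : sets containing no member of 𝓢.
𝓗 : ∀ {n} → Family n → Family n
𝓗 {n} 𝓢 X = not (any (λ S → 𝓢 S ∧ (S ⊆ᵇ X)) (allSubsets n))

-- 𝓕(𝓢,h) = 2^[n] ∖ ⋃_{S∈𝓢} 𝓠_{S,h(S)} : sets X with X ∩ S ≠ h(S) for all S ∈ 𝓢.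
𝓕[_,_] : ∀ {n} → Family n → (Subset n → Subset n) → Family n
𝓕[_,_] {n} 𝓢 h X = not (any (λ S → 𝓢 S ∧ ((X ∩ S) =ˢ h S)) (allSubsets n))

-- The argument is a squeeze between two inclusions of cardinalities:
--   * Pajor's lemma  |𝓕| ≤ |Sh 𝓕|, valid for every family, proved by induction
--     on n via the two sections of 𝓕 along the first coordinate and the
--     counting identity |A ∪ B| + |A ∩ B| = |A| + |B|;
--   * Sh 𝓕(𝓢,h) ⊆ 𝓗(𝓢): if 𝓕 shattered a set X ⊇ S with S ∈ 𝓢, it would
--     shatter S (shattering is hereditary), so some member G would have the
--     forbidden trace G ∩ S = h(S).
-- Hence |𝓕| ≤ |Sh 𝓕| ≤ |𝓗(𝓢)|; if the outer terms agree, all three do, and a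
-- subfamily with as many members as the whole family is the whole family.
module Submission where

open import Defs
open import Data.Nat using (ℕ)
open import Data.Bool using (true)
open import Data.Product using (_×_)
open import Data.Fin.Subset using (Subset; _⊆_)
open import Function.Bundles using (_⇔_)
open import Relation.Binary.PropositionalEquality using (_≡_)

open import Data.Nat using (zero; suc; _+_; _≤_; z≤n; s≤s)
open import Data.Nat.Properties
  using (≤-antisym; +-mono-≤; +-suc; m≤n⇒m≤1+n; 1+n≰n; suc-injective; module ≤-Reasoning)
open import Data.Bool using (Bool; false; T; not; _∧_; _∨_)
open import Data.Bool.Properties using (T-≡; T-∧; T-∨)
open import Data.Bool.ListAction using (any; all)
open import Data.Unit using (tt)
open import Data.Empty using (⊥-elim)
open import Data.Product using (∃; _,_; proj₁; proj₂)
open import Data.Sum using (inj₁; inj₂)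
open import Data.List using (List; []; _∷_; _++_; map; length; filterᵇ)
open import Data.List.Properties using (filter-++; length-++)
open import Data.List.Membership.Propositional using (_∈_; lose)
open import Data.List.Membership.Propositional.Properties using (∈-map⁺; ∈-++⁺ˡ; ∈-++⁺ʳ)
open import Data.List.Relation.Unary.Any using (here; there; satisfied)
open import Data.List.Relation.Unary.Any.Properties using (any⁺; any⁻)
open import Data.List.Relation.Unary.All using (tabulate)
import Data.List.Relation.Unary.All as All
open import Data.List.Relation.Unary.All.Properties using (all⁺; all⁻)
open import Data.Vec using ([]; _∷_; here)
open import Data.Fin.Subset using (_∩_; inside; outside)
open import Data.Fin.Subset.Properties using (_⊆?_; drop-∷-⊆; ⊆-antisym; ⊆-trans; p∩q⊆q; x∈p∩q⁺; ∩-comm; ∩-assoc)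
open import Relation.Nullary using (¬_; contradiction)
open import Relation.Nullary.Decidable using (toWitness; fromWitness)
open import Function.Bundles using (mk⇔; Equivalence)
open import Relation.Binary.PropositionalEquality using (_≢_; refl; sym; trans; cong; cong₂; subst; module ≡-Reasoning)

private
  variable
    n : ℕ
    A B : Set

T-not : {b : Bool} → T (not b) ⇔ (¬ T b)
T-not {false} = mk⇔ (λ _ ()) (λ _ → tt)
T-not {true}  = mk⇔ (λ ()) (λ ¬t → ¬t tt)

T-⇒ : {a b : Bool} → T (not a ∨ b) ⇔ (T a → T b)
T-⇒ {false} = mk⇔ (λ _ ()) (λ _ → tt)
T-⇒ {true}  = mk⇔ (λ tb _ → tb) (λ f → f tt)

T-ext : {a b : Bool} → (T a → T b) → (T b → T a) → a ≡ b
T-ext {false} {false} _ _ = refl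
T-ext {false} {true}  _ g = ⊥-elim (g tt)
T-ext {true}  {false} f _ = ⊥-elim (f tt)
T-ext {true}  {true}  _ _ = refl

∈-allSubsets : (X : Subset n) → X ∈ allSubsets n
∈-allSubsets []            = here refl
∈-allSubsets (outside ∷ X) = ∈-++⁺ˡ (∈-map⁺ (outside ∷_) (∈-allSubsets X))
∈-allSubsets (inside ∷ X)  = ∈-++⁺ʳ _ (∈-map⁺ (inside ∷_) (∈-allSubsets X))

module _ (p : Subset n → Bool) where

  any-intro : (X : Subset n) → T (p X) → T (any p (allSubsets n))
  any-intro X pX = any⁺ {xs = allSubsets n} p (lose (∈-allSubsets X) pX)

  any-elim : T (any p (allSubsets n)) → ∃ λ X → T (p X)
  any-elim t = satisfied (any⁻ p (allSubsets n) t)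

  all-intro : ((X : Subset n) → T (p X)) → T (all p (allSubsets n))
  all-intro f = all⁻ p {xs = allSubsets n} (tabulate (λ {X} _ → f X))

  all-elim : T (all p (allSubsets n)) → (X : Subset n) → T (p X)
  all-elim t X = All.lookup (all⁺ p _ t) (∈-allSubsets X)

count : (A → Bool) → List A → ℕ
count p xs = length (filterᵇ p xs)

count-++ : (p : A → Bool) (xs ys : List A) → count p (xs ++ ys) ≡ count p xs + count p ys
count-++ p xs ys = trans (cong length (filter-++ _ xs ys)) (length-++ (filterᵇ p xs))

count-map : (p : B → Bool) (f : A → B) (xs : List A) →
  count p (map f xs) ≡ count (λ x → p (f x)) xs
count-map p f []       = refl
count-map p f (x ∷ xs) with p (f x)
... | true  = cong suc (count-map p f xs)
... | false = count-map p f xs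

count-mono : (p q : A → Bool) → (∀ x → T (p x) → T (q x)) →
  (xs : List A) → count p xs ≤ count q xs
count-mono p q p⇒q []       = z≤n
count-mono p q p⇒q (x ∷ xs) with p x | q x | p⇒q x
... | true  | true  | _   = s≤s (count-mono p q p⇒q xs)
... | true  | false | p⇒q = ⊥-elim (p⇒q tt)
... | false | true  | _   = m≤n⇒m≤1+n (count-mono p q p⇒q xs)
... | false | false | _   = count-mono p q p⇒q xs

count-not-above : (p q : A → Bool) → (∀ x → T (p x) → T (q x)) →
  (xs : List A) → count p xs ≢ suc (count q xs)
count-not-above p q p⇒q xs eq = 1+n≰n (subst (_≤ count q xs) eq (count-mono p q p⇒q xs))

count-reflect : (p q : A → Bool) → (∀ x → T (p x) → T (q x)) →
  (xs : List A) → count p xs ≡ count q xs → ∀ {y} → y ∈ xs → T (q y) → T (p y)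
count-reflect p q p⇒q (x ∷ xs) eq (here refl) qx with p x | q x | p⇒q x
... | true  | _     | _ = tt
... | false | true  | _ = ⊥-elim (count-not-above p q p⇒q xs eq)
... | false | false | _ = qx
count-reflect p q p⇒q (x ∷ xs) eq (there y∈xs) qy with p x | q x | p⇒q x
... | true  | true  | _   = count-reflect p q p⇒q xs (suc-injective eq) y∈xs qy
... | true  | false | p⇒q' = ⊥-elim (p⇒q' tt)
... | false | true  | _   = ⊥-elim (count-not-above p q p⇒q xs eq)
... | false | false | _   = count-reflect p q p⇒q xs eq y∈xs qy

count-∨-∧ : (p q : A → Bool) (xs : List A) →
  count (λ x → p x ∨ q x) xs + count (λ x → p x ∧ q x) xs ≡ count p xs + count q xs
count-∨-∧ p q []       = refl
count-∨-∧ p q (x ∷ xs) with p x | q x | count-∨-∧ p q xs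
... | true  | true  | ih = cong suc (trans (+-suc _ _) (trans (cong suc ih) (sym (+-suc _ _))))
... | true  | false | ih = cong suc ih
... | false | true  | ih = trans (cong suc ih) (sym (+-suc _ _))
... | false | false | ih = ih

_⊑_ : Family n → Family n → Set
_⊑_ {n} 𝓐 𝓑 = (X : Subset n) → T (𝓐 X) → T (𝓑 X)

_∪ᶠ_ _∩ᶠ_ : Family n → Family n → Family n
(𝓐 ∪ᶠ 𝓑) X = 𝓐 X ∨ 𝓑 X
(𝓐 ∩ᶠ 𝓑) X = 𝓐 X ∧ 𝓑 X

section : Bool → Family (suc n) → Family n
section b 𝓐 X = 𝓐 (b ∷ X)

card-mono : {𝓐 𝓑 : Family n} → 𝓐 ⊑ 𝓑 → card 𝓐 ≤ card 𝓑
card-mono {n} 𝓐⊑𝓑 = count-mono _ _ 𝓐⊑𝓑 (allSubsets n)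

card-cong : {𝓐 𝓑 : Family n} → 𝓐 ≐ 𝓑 → card 𝓐 ≡ card 𝓑
card-cong 𝓐≐𝓑 = ≤-antisym (card-mono (λ X → subst T (𝓐≐𝓑 X)))
                           (card-mono (λ X → subst T (sym (𝓐≐𝓑 X))))

card-squeeze : {𝓐 𝓑 : Family n} → 𝓐 ⊑ 𝓑 → card 𝓑 ≤ card 𝓐 → 𝓐 ≐ 𝓑
card-squeeze {n} {𝓐} {𝓑} 𝓐⊑𝓑 |𝓑|≤|𝓐| X =
  T-ext (𝓐⊑𝓑 X) (count-reflect _ _ 𝓐⊑𝓑 (allSubsets n) |𝓐|≡|𝓑| (∈-allSubsets X))
  where
  |𝓐|≡|𝓑| : card 𝓐 ≡ card 𝓑
  |𝓐|≡|𝓑| = ≤-antisym (card-mono 𝓐⊑𝓑) |𝓑|≤|𝓐|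

card-sections : (𝓐 : Family (suc n)) →
  card 𝓐 ≡ card (section outside 𝓐) + card (section inside 𝓐)
card-sections {n} 𝓐 = trans (count-++ 𝓐 (map (outside ∷_) 2ⁿ) (map (inside ∷_) 2ⁿ))
  (cong₂ _+_ (count-map 𝓐 (outside ∷_) 2ⁿ) (count-map 𝓐 (inside ∷_) 2ⁿ))
  where
  2ⁿ : List (Subset n)
  2ⁿ = allSubsets n

card-∪-∩ : (𝓐 𝓑 : Family n) → card (𝓐 ∪ᶠ 𝓑) + card (𝓐 ∩ᶠ 𝓑) ≡ card 𝓐 + card 𝓑
card-∪-∩ {n} 𝓐 𝓑 = count-∨-∧ 𝓐 𝓑 (allSubsets n)

Shatters : Family n → Subset n → Set
Shatters {n} 𝓐 S = (U : Subset n) → U ⊆ S → ∃ λ G → T (𝓐 G) × G ∩ S ≡ U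

Sh⇔Shatters : {𝓐 : Family n} {S : Subset n} → T (Sh 𝓐 S) ⇔ Shatters 𝓐 S
Sh⇔Shatters {n} {𝓐} {S} = mk⇔ sound complete
  where
  sound : T (Sh 𝓐 S) → Shatters 𝓐 S
  sound t U U⊆S =
    let (G , trace) = any-elim _ (Equivalence.to T-⇒ (all-elim _ t U) (fromWitness {a? = U ⊆? S} U⊆S))
        (G∈𝓐 , G∩S≡U) = Equivalence.to T-∧ trace
    in G , G∈𝓐 , toWitness G∩S≡U
  complete : Shatters 𝓐 S → T (Sh 𝓐 S)
  complete sh = all-intro _ λ U → Equivalence.from T-⇒ λ U⊆S →
    let (G , G∈𝓐 , G∩S≡U) = sh U (toWitness {a? = U ⊆? S} U⊆S)
    in any-intro _ G (Equivalence.from T-∧ (G∈𝓐 , fromWitness G∩S≡U))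

∩-absorb : {S X : Subset n} → S ⊆ X → X ∩ S ≡ S
∩-absorb {S = S} {X} S⊆X = ⊆-antisym (p∩q⊆q X S) (λ x∈S → x∈p∩q⁺ (S⊆X x∈S , x∈S))

shatters-⊆ : {𝓐 : Family n} {S X : Subset n} → Shatters 𝓐 X → S ⊆ X → Shatters 𝓐 S
shatters-⊆ {S = S} {X} sh S⊆X U U⊆S with sh U (⊆-trans U⊆S S⊆X)
... | G , G∈𝓐 , G∩X≡U = G , G∈𝓐 , G∩S≡U
  where
  open ≡-Reasoning
  G∩S≡U : G ∩ S ≡ U
  G∩S≡U = begin
    G ∩ S        ≡⟨ cong (G ∩_) (∩-absorb S⊆X) ⟨
    G ∩ (X ∩ S)  ≡⟨ ∩-assoc G X S ⟨
    (G ∩ X) ∩ S  ≡⟨ cong (_∩ S) G∩X≡U ⟩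
    U ∩ S        ≡⟨ ∩-comm U S ⟩
    S ∩ U        ≡⟨ ∩-absorb U⊆S ⟩
    U            ∎

shatters-∪ᶠ : {𝓐 : Family (suc n)} {S : Subset n} →
  Shatters (section outside 𝓐 ∪ᶠ section inside 𝓐) S → Shatters 𝓐 (outside ∷ S)
shatters-∪ᶠ sh (inside ∷ U)  U⊆S = contradiction (U⊆S here) λ ()
shatters-∪ᶠ sh (outside ∷ U) U⊆S with sh U (drop-∷-⊆ U⊆S)
... | G , G∈𝓐₀∪𝓐₁ , G∩S≡U with Equivalence.to T-∨ G∈𝓐₀∪𝓐₁
...   | inj₁ G∈𝓐₀ = outside ∷ G , G∈𝓐₀ , cong (outside ∷_) G∩S≡U
...   | inj₂ G∈𝓐₁ = inside ∷ G , G∈𝓐₁ , cong (outside ∷_) G∩S≡U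

shatters-∩ᶠ : {𝓐 : Family (suc n)} {S : Subset n} →
  Shatters (section outside 𝓐 ∩ᶠ section inside 𝓐) S → Shatters 𝓐 (inside ∷ S)
shatters-∩ᶠ sh (u ∷ U) U⊆S with sh U (drop-∷-⊆ U⊆S) | u
... | G , G∈𝓐₀∩𝓐₁ , G∩S≡U | outside =
  outside ∷ G , proj₁ (Equivalence.to T-∧ G∈𝓐₀∩𝓐₁) , cong (outside ∷_) G∩S≡U
... | G , G∈𝓐₀∩𝓐₁ , G∩S≡U | inside =
  inside ∷ G , proj₂ (Equivalence.to T-∧ G∈𝓐₀∩𝓐₁) , cong (inside ∷_) G∩S≡U

pajor : (𝓐 : Family n) → card 𝓐 ≤ card (Sh 𝓐)
pajor {zero} 𝓐 = card-mono {𝓐 = 𝓐} {𝓑 = Sh 𝓐} 𝓐⊑Sh𝓐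
  where
  -- On [0] the only set is ∅, and a nonempty family shatters ∅.
  𝓐⊑Sh𝓐 : 𝓐 ⊑ Sh 𝓐
  𝓐⊑Sh𝓐 [] []∈𝓐 = Equivalence.from (Sh⇔Shatters {𝓐 = 𝓐} {S = []}) λ { [] _ → [] , []∈𝓐 , refl }
pajor {suc n} 𝓐 = begin
  card 𝓐                                  ≡⟨ card-sections 𝓐 ⟩
  card 𝓐₀ + card 𝓐₁                       ≡⟨ card-∪-∩ 𝓐₀ 𝓐₁ ⟨
  card (𝓐₀ ∪ᶠ 𝓐₁) + card (𝓐₀ ∩ᶠ 𝓐₁)        ≤⟨ +-mono-≤ (pajor (𝓐₀ ∪ᶠ 𝓐₁)) (pajor (𝓐₀ ∩ᶠ 𝓐₁)) ⟩
  card (Sh (𝓐₀ ∪ᶠ 𝓐₁)) + card (Sh (𝓐₀ ∩ᶠ 𝓐₁))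
    ≤⟨ +-mono-≤ (card-mono (Sh-section shatters-∪ᶠ)) (card-mono (Sh-section shatters-∩ᶠ)) ⟩
  card (section outside (Sh 𝓐)) + card (section inside (Sh 𝓐)) ≡⟨ card-sections (Sh 𝓐) ⟨
  card (Sh 𝓐)                             ∎
  where
  open ≤-Reasoning
  𝓐₀ 𝓐₁ : Family n
  𝓐₀ = section outside 𝓐
  𝓐₁ = section inside 𝓐
  Sh-section : {𝓑 : Family n} {b : Bool} → (∀ {S} → Shatters 𝓑 S → Shatters 𝓐 (b ∷ S)) →
    Sh 𝓑 ⊑ section b (Sh 𝓐)
  Sh-section shatters S t = Equivalence.from Sh⇔Shatters (shatters (Equivalence.to Sh⇔Shatters t))

𝓕-avoids : {𝓢 : Family n} {h : Subset n → Subset n} {G S : Subset n} →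
  T (𝓕[ 𝓢 , h ] G) → T (𝓢 S) → G ∩ S ≢ h S
𝓕-avoids {S = S} G∈𝓕 S∈𝓢 G∩S≡hS =
  Equivalence.to T-not G∈𝓕 (any-intro _ S (Equivalence.from T-∧ (S∈𝓢 , fromWitness G∩S≡hS)))

𝓗-intro : {𝓢 : Family n} {X : Subset n} → ((S : Subset n) → T (𝓢 S) → ¬ S ⊆ X) → T (𝓗 𝓢 X)
𝓗-intro {X = X} free = Equivalence.from T-not λ t →
  let (S , S∈𝓢∧S⊆X) = any-elim _ t
      (S∈𝓢 , S⊆X) = Equivalence.to T-∧ S∈𝓢∧S⊆X
  in free S S∈𝓢 (toWitness {a? = S ⊆? X} S⊆X)

-- Sh 𝓕(𝓢,h) ⊆ 𝓗(𝓢): a shattered X ⊇ S ∈ 𝓢 would make h(S) a trace on S.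
Sh𝓕⊑𝓗 : {𝓢 : Family n} {h : Subset n → Subset n} →
  ((S : Subset n) → T (𝓢 S) → h S ⊆ S) → Sh 𝓕[ 𝓢 , h ] ⊑ 𝓗 𝓢
Sh𝓕⊑𝓗 {h = h} hS⊆S X X∈Sh = 𝓗-intro λ S S∈𝓢 S⊆X →
  let (G , G∈𝓕 , G∩S≡hS) = shatters-⊆ (Equivalence.to Sh⇔Shatters X∈Sh) S⊆X (h S) (hS⊆S S S∈𝓢)
  in 𝓕-avoids G∈𝓕 S∈𝓢 G∩S≡hS

proposition7 : (n : ℕ) (𝓢 : Family n) (h : Subset n → Subset n) →
    Sperner 𝓢 →
    ((S : Subset n) → 𝓢 S ≡ true → h S ⊆ S) →
    (SExtremal 𝓕[ 𝓢 , h ] × (Sh 𝓕[ 𝓢 , h ] ≐ 𝓗 𝓢)) ⇔ (card 𝓕[ 𝓢 , h ] ≡ card (𝓗 𝓢))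
proposition7 n 𝓢 h _ hS⊆S = mk⇔ extremal⇒card card⇒extremal
  where
  𝓕 : Family n
  𝓕 = 𝓕[ 𝓢 , h ]
  Sh𝓕⊑𝓗𝓢 : Sh 𝓕 ⊑ 𝓗 𝓢
  Sh𝓕⊑𝓗𝓢 = Sh𝓕⊑𝓗 (λ S S∈𝓢 → hS⊆S S (Equivalence.to T-≡ S∈𝓢))

  extremal⇒card : SExtremal 𝓕 × (Sh 𝓕 ≐ 𝓗 𝓢) → card 𝓕 ≡ card (𝓗 𝓢)
  extremal⇒card (|Sh𝓕|≡|𝓕| , Sh𝓕≐𝓗) = trans (sym |Sh𝓕|≡|𝓕|) (card-cong Sh𝓕≐𝓗)

  -- |𝓗| = |𝓕| ≤ |Sh 𝓕| ≤ |𝓗| forces Sh 𝓕 = 𝓗, and then |Sh 𝓕| = |𝓗| = |𝓕|.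
  card⇒extremal : card 𝓕 ≡ card (𝓗 𝓢) → SExtremal 𝓕 × (Sh 𝓕 ≐ 𝓗 𝓢)
  card⇒extremal |𝓕|≡|𝓗| = trans (card-cong Sh𝓕≐𝓗) (sym |𝓕|≡|𝓗|) , Sh𝓕≐𝓗
    where
    Sh𝓕≐𝓗 : Sh 𝓕 ≐ 𝓗 𝓢
    Sh𝓕≐𝓗 = card-squeeze Sh𝓕⊑𝓗𝓢 (subst (_≤ card (Sh 𝓕)) |𝓕|≡|𝓗| (pajor 𝓕))
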